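{- Let $A$ be a real symmetric $n\times n$ matrix, $i\in[n]$, and $B$ a real symmetric $m\times m$ matrix. Then the direct sum $A\oplus B$ has the $i$-SNIP if and only if $A$ has the $i$-SNIP and $B$ is nonsingular.
   Context: A symmetric matrix $M$ has the $i$-SNIP if $X=O$ is the only real symmetric matrix $X$ (of the same size) with $M\circ X=O$, $I\circ X=O$ ($\circ$ the entrywise product) and $(MX)(i,:]=O$, where $(MX)(i,:]$ is $MX$ with row $i$ deleted. In $A\oplus B$ the index $i$ refers to the $i$-th row/column, lying in the $A$ block. -}

module Defs where

open import Level using (Level; suc; _⊔_)
open import Algebra.Bundles using (CommutativeRing)
open import Data.Nat.Base using (ℕ) renaming (_+_ to _+ℕ_)
open import Data.Fin.Base using (Fin; splitAt)
open import Data.Fin.Properties using (_≟_)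
open import Data.Sum.Base using (inj₁; inj₂)
open import Data.Product.Base using (∃; _×_)
open import Relation.Nullary using (¬_; yes; no)
open import Relation.Binary.Structures using (IsTotalOrder)
open import Relation.Binary.PropositionalEquality using (_≢_)
import Algebra.Definitions.RawMonoid as RM

-- The real numbers, axiomatised (up to isomorphism) as a Dedekind-complete
-- ordered field.  Any R : RealField c ℓ is a model of ℝ.
record RealField c ℓ : Set (suc (c ⊔ ℓ)) where
  field
    commutativeRing : CommutativeRing c ℓ
  open CommutativeRing commutativeRing public
  field
    0≉1       : ¬ (0# ≈ 1#)
    inverse   : ∀ x → ¬ (x ≈ 0#) → ∃ λ y → x * y ≈ 1#
    _≤_       : Carrier → Carrier → Set ℓ
    isTotalOrder : IsTotalOrder _≈_ _≤_
    +-mono-≤  : ∀ {x y} z → x ≤ y → (x + z) ≤ (y + z)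
    *-nonneg  : ∀ {x y} → 0# ≤ x → 0# ≤ y → 0# ≤ (x * y)
    lub : (S : Carrier → Set ℓ) → ∃ S → (∃ λ b → ∀ s → S s → s ≤ b) →
          ∃ λ u → (∀ s → S s → s ≤ u) × (∀ b → (∀ s → S s → s ≤ b) → u ≤ b)

module Matrices {c ℓ} (R : RealField c ℓ) where
  open RealField R

  Matrix : ℕ → ℕ → Set c
  Matrix m n = Fin m → Fin n → Carrier

  Σ[_] : ∀ {n} → (Fin n → Carrier) → Carrier
  Σ[_] = RM.sum +-rawMonoid

  _·_ : ∀ {m n p} → Matrix m n → Matrix n p → Matrix m p
  (M · N) i k = Σ[ (λ j → M i j * N j k) ]

  I : ∀ {n} → Matrix n n
  I i j with i ≟ j
  ... | yes _ = 1#
  ... | no  _ = 0#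

  _≈ₘ_ : ∀ {m n} → Matrix m n → Matrix m n → Set ℓ
  M ≈ₘ N = ∀ i j → M i j ≈ N i j

  Symmetric : ∀ {n} → Matrix n n → Set ℓ
  Symmetric M = ∀ i j → M i j ≈ M j i

  Nonsingular : ∀ {n} → Matrix n n → Set (c ⊔ ℓ)
  Nonsingular {n} M = ∃ λ (C : Matrix n n) → ((M · C) ≈ₘ I) × ((C · M) ≈ₘ I)

  _⊕_ : ∀ {n m} → Matrix n n → Matrix m m → Matrix (n +ℕ m) (n +ℕ m)
  _⊕_ {n} A B p q with splitAt n p | splitAt n q
  ... | inj₁ a | inj₁ b = A a b
  ... | inj₂ a | inj₂ b = B a b
  ... | inj₁ _ | inj₂ _ = 0#
  ... | inj₂ _ | inj₁ _ = 0#

  SNIP : ∀ {n} → Fin n → Matrix n n → Set (c ⊔ ℓ)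
  SNIP {n} i M = (X : Matrix n n) → Symmetric X →
    (∀ j k → M j k * X j k ≈ 0#) →
    (∀ j k → I j k * X j k ≈ 0#) →
    (∀ j k → j ≢ i → (M · X) j k ≈ 0#) →
    ∀ j k → X j k ≈ 0#

-- Write a symmetric test matrix with vanishing lower-right block as
-- X = [X₁₁ X₁₂; X₁₂ᵀ O].  Its SNIP conditions for A ⊕ B are the SNIP conditions
-- for A on X₁₁, together with A X₁₂ vanishing off row i and B X₁₂ᵀ = O.  With
-- X₁₂ = O this gives the i-SNIP of A; with X₁₂ = u vᵀ, where B v = 0 and A u
-- vanishes off row i, it gives u vᵀ = O.  Such a u ≠ 0 always exists (A u = eᵢ
-- if A is injective, a kernel vector otherwise), so B is injective and hence,
-- by Gaussian elimination, invertible.  Conversely, if B is invertible, the rows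
-- of (A ⊕ B) X through B force the lower rows of X, and by symmetry its right
-- columns, to vanish; the i-SNIP of A then kills the upper-left block.
module Submission where

open import Defs
open import Level using (Level; _⊔_)
open import Data.Nat.Base using (ℕ; zero; suc) renaming (_+_ to _+ℕ_)
open import Data.Fin.Base using (Fin; zero; suc; _↑ˡ_; _↑ʳ_; splitAt; punchIn; punchOut)
open import Data.Fin.Properties
  using (splitAt-↑ˡ; splitAt-↑ʳ; ↑ˡ-injective; ↑ʳ-injective; suc-injective; punchIn-punchOut; sequence)
  renaming (_≟_ to _≟ᶠ_)
open import Data.Product.Base using (_×_; _,_; proj₁; proj₂; ∃; ∃₂)
open import Data.Sum.Base using (inj₁; inj₂)
open import Data.Empty using (⊥)
open import Data.Vec.Functional using (Vector)
open import Effect.Monad using (RawMonad)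
open import Function.Base using (_∘_)
open import Function.Bundles using (_⇔_; mk⇔)
open import Relation.Nullary using (¬_; Dec; yes; no; contradiction)
open import Relation.Nullary.Decidable using (¬¬-excluded-middle)
open import Relation.Nullary.Negation using (¬¬-Monad; ¬¬-map)
open import Relation.Binary.Structures using (IsTotalOrder)
open import Relation.Binary.PropositionalEquality as ≡ using (_≡_; _≢_)
import Algebra.Properties.Semiring.Sum as SemiringSum
import Algebra.Properties.Ring as RingProperties
import Algebra.Properties.Group as GroupProperties
import Data.Vec.Functional.Relation.Binary.Equality.Setoid as VectorEquality
import Relation.Binary.Reasoning.Setoid as SetoidReasoning

private
  variable
    p : Level
    k n m : ℕ

↑-elim : {P : Fin (n +ℕ m) → Set p} →
         (∀ a → P (a ↑ˡ m)) → (∀ b → P (n ↑ʳ b)) → ∀ x → P x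
↑-elim {n = zero}  left right x       = right x
↑-elim {n = suc n} left right zero    = left zero
↑-elim {n = suc n} left right (suc x) = ↑-elim (left ∘ suc) right x

↑-elim₂ : {P : Fin (n +ℕ m) → Fin (n +ℕ m) → Set p} →
          (∀ a b → P (a ↑ˡ m) (b ↑ˡ m)) → (∀ a b → P (a ↑ˡ m) (n ↑ʳ b)) →
          (∀ a b → P (n ↑ʳ a) (b ↑ˡ m)) → (∀ a b → P (n ↑ʳ a) (n ↑ʳ b)) →
          ∀ x y → P x y
↑-elim₂ P₁₁ P₁₂ P₂₁ P₂₂ =
  ↑-elim (λ a → ↑-elim (P₁₁ a) (P₁₂ a)) (λ a → ↑-elim (P₂₁ a) (P₂₂ a))

↑ˡ≢↑ʳ : (a : Fin n) (b : Fin m) → a ↑ˡ m ≢ n ↑ʳ b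
↑ˡ≢↑ʳ zero    b ()
↑ˡ≢↑ʳ (suc a) b eq = ↑ˡ≢↑ʳ a b (suc-injective eq)

punchIn-elim : {P : Fin (suc k) → Set p} (r : Fin (suc k)) →
               P r → (∀ j → P (punchIn r j)) → ∀ j → P j
punchIn-elim {P = P} r Pr P-punchIn j with r ≟ᶠ j
... | yes ≡.refl = Pr
... | no r≢j     = ≡.subst P (punchIn-punchOut r≢j) (P-punchIn (punchOut r≢j))

module _ {c ℓ} (R : RealField c ℓ) where

  open RealField R hiding (zero)
  open Matrices R
  open SemiringSum semiring using (sum-cong-≋; sum-replicate-zero; ∑-distrib-+; ∑-comm; *-distribˡ-sum; *-distribʳ-sum)
  open RingProperties ring using (-‿distribˡ-*; -‿distribʳ-*; x[y-z]≈xy-xz; [y-z]x≈yx-zx)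
  open GroupProperties +-group using (⁻¹-involutive; //-rightDividesˡ)
  open VectorEquality setoid using (_≋_)
  open SetoidReasoning setoid
  module ≤ = IsTotalOrder isTotalOrder

  *≈0⇒≈0 : ∀ {x y} → ¬ (y ≈ 0#) → x * y ≈ 0# → x ≈ 0#
  *≈0⇒≈0 {x} {y} y≉0 xy≈0 with inverse y y≉0
  ... | z , yz≈1 = begin
    x             ≈⟨ sym (*-identityʳ x) ⟩
    x * 1#        ≈⟨ *-congˡ (sym yz≈1) ⟩
    x * (y * z)   ≈⟨ sym (*-assoc x y z) ⟩
    x * y * z     ≈⟨ *-congʳ xy≈0 ⟩
    0# * z        ≈⟨ zeroˡ z ⟩
    0#            ∎

  square≈0⇒¬¬≈0 : ∀ {x} → x * x ≈ 0# → ¬ ¬ (x ≈ 0#)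
  square≈0⇒¬¬≈0 x²≈0 x≉0 = x≉0 (*≈0⇒≈0 x≉0 x²≈0)

  square-nonneg : ∀ x → 0# ≤ (x * x)
  square-nonneg x with ≤.total 0# x
  ... | inj₁ 0≤x = *-nonneg 0≤x 0≤x
  ... | inj₂ x≤0 = ≤.≲-respʳ-≈ -x*-x≈x*x (*-nonneg 0≤-x 0≤-x)
    where
    -x*-x≈x*x : - x * - x ≈ x * x
    -x*-x≈x*x = trans (sym (-‿distribˡ-* x (- x)))
                      (trans (-‿cong (sym (-‿distribʳ-* x x))) (⁻¹-involutive (x * x)))

    0≤-x : 0# ≤ (- x)
    0≤-x = ≤.≲-respʳ-≈ (+-identityˡ (- x)) (≤.≲-respˡ-≈ (-‿inverseʳ x) (+-mono-≤ (- x) x≤0))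

  argmax : (f : Vector Carrier (suc k)) → ∃ λ r → ∀ j → f j ≤ f r
  argmax {zero}  f = zero , λ { zero → ≤.refl }
  argmax {suc k} f with argmax (f ∘ suc)
  ... | r , f≤fr with ≤.total (f zero) (f (suc r))
  ... | inj₁ f₀≤fr = suc r , λ { zero → f₀≤fr ; (suc j) → f≤fr j }
  ... | inj₂ fr≤f₀ = zero  , λ { zero → ≤.refl ; (suc j) → ≤.trans (f≤fr j) fr≤f₀ }

  ¬¬-∀ : {P : Fin n → Set ℓ} → (∀ j → ¬ ¬ P j) → ¬ ¬ (∀ j → P j)
  ¬¬-∀ = sequence (RawMonad.rawApplicative ¬¬-Monad)

  0ᵥ : Vector Carrier n
  0ᵥ _ = 0#

  O : Matrix n m
  O _ _ = 0#

  infixl 7 _·ᵥ_ _⊙_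
  infix 6 _⊗_

  _·ᵥ_ : Matrix n m → Vector Carrier m → Vector Carrier n
  (M ·ᵥ x) j = Σ[ (λ l → M j l * x l) ]

  _⊗_ : Vector Carrier n → Vector Carrier m → Matrix n m
  (u ⊗ v) a b = u a * v b

  _⊙_ : Matrix n m → Matrix n m → Matrix n m
  (M ⊙ X) a b = M a b * X a b

  _ᵀ : Matrix n m → Matrix m n
  (M ᵀ) a b = M b a

  ZeroOff : Fin n → Vector Carrier n → Set ℓ
  ZeroOff i w = ∀ j → j ≢ i → w j ≈ 0#

  ZeroOffRow : Fin n → Matrix n m → Set ℓ
  ZeroOffRow i Y = ∀ j k → j ≢ i → Y j k ≈ 0#

  -- Injectivity up to double negation: with undecidable equality of reals this
  -- is all the SNIP can give, and it suffices for elimination since a pivot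
  -- only has to be ≉ 0.
  WeaklyInjective : Matrix n n → Set (c ⊔ ℓ)
  WeaklyInjective M = ∀ v → M ·ᵥ v ≋ 0ᵥ → ¬ ¬ (v ≋ 0ᵥ)

  sum-zero : {f : Vector Carrier n} → f ≋ 0ᵥ → Σ[ f ] ≈ 0#
  sum-zero {n} f≋0 = trans (sum-cong-≋ f≋0) (sum-replicate-zero n)

  sum-↑ : ∀ n (f : Vector Carrier (n +ℕ m)) → Σ[ f ] ≈ Σ[ f ∘ (_↑ˡ m) ] + Σ[ f ∘ (n ↑ʳ_) ]
  sum-↑ zero    f = sym (+-identityˡ _)
  sum-↑ (suc n) f = trans (+-congˡ (sum-↑ n (f ∘ suc))) (sym (+-assoc _ _ _))

  ·ᵥ-assoc : (M : Matrix n m) (N : Matrix m k) (x : Vector Carrier k) →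
             (M · N) ·ᵥ x ≋ M ·ᵥ (N ·ᵥ x)
  ·ᵥ-assoc M N x a = begin
    Σ[ (λ l → Σ[ (λ j → M a j * N j l) ] * x l) ]
      ≈⟨ sum-cong-≋ (λ l → *-distribʳ-sum (x l) (λ j → M a j * N j l)) ⟩
    Σ[ (λ l → Σ[ (λ j → M a j * N j l * x l) ]) ]
      ≈⟨ sym (∑-comm (λ j l → M a j * N j l * x l)) ⟩
    Σ[ (λ j → Σ[ (λ l → M a j * N j l * x l) ]) ]
      ≈⟨ sum-cong-≋ (λ j → sum-cong-≋ (λ l → *-assoc (M a j) (N j l) (x l))) ⟩
    Σ[ (λ j → Σ[ (λ l → M a j * (N j l * x l)) ]) ]
      ≈⟨ sum-cong-≋ (λ j → sym (*-distribˡ-sum (M a j) (λ l → N j l * x l))) ⟩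
    Σ[ (λ j → M a j * (N ·ᵥ x) j) ]
      ∎

  ·-assoc : (M : Matrix n m) (N : Matrix m k) (P : Matrix k k) → ((M · N) · P) ≈ₘ (M · (N · P))
  ·-assoc M N P a b = ·ᵥ-assoc M N (λ l → P l b) a

  ·-congˡ : (M : Matrix n m) {X Y : Matrix m k} → X ≈ₘ Y → (M · X) ≈ₘ (M · Y)
  ·-congˡ M X≈Y a b = sum-cong-≋ (λ j → *-congˡ (X≈Y j b))

  ·-congʳ : {X Y : Matrix n m} (N : Matrix m k) → X ≈ₘ Y → (X · N) ≈ₘ (Y · N)
  ·-congʳ N X≈Y a b = sum-cong-≋ (λ j → *-congʳ (X≈Y a j))

  ·-zeroʳ : (M : Matrix n m) → (M · O {m} {k}) ≈ₘ O
  ·-zeroʳ M a b = sum-zero (λ j → zeroʳ (M a j))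

  ·-⊗ : (M : Matrix n m) (u : Vector Carrier m) (v : Vector Carrier k) →
        (M · (u ⊗ v)) ≈ₘ (M ·ᵥ u ⊗ v)
  ·-⊗ M u v a b = trans (sum-cong-≋ (λ j → sym (*-assoc (M a j) (u j) (v b))))
                        (sym (*-distribʳ-sum (v b) (λ j → M a j * u j)))

  I-≡ : {a b : Fin n} → a ≡ b → I a b ≈ 1#
  I-≡ {a = a} ≡.refl with a ≟ᶠ a
  ... | yes _   = refl
  ... | no a≢a  = contradiction ≡.refl a≢a

  I-refl : (a : Fin n) → I a a ≈ 1#
  I-refl a = I-≡ {a = a} ≡.refl

  I-≢ : {a b : Fin n} → a ≢ b → I a b ≈ 0#
  I-≢ {a = a} {b} a≢b with a ≟ᶠ b
  ... | yes a≡b = contradiction a≡b a≢b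
  ... | no _    = refl

  I-cong-⇔ : {a b : Fin n} {c d : Fin m} → (a ≡ b → c ≡ d) → (c ≡ d → a ≡ b) → I a b ≈ I c d
  I-cong-⇔ {a = a} {b} {c} {d} to from = decide (a ≟ᶠ b)
    where
    decide : Dec (a ≡ b) → I a b ≈ I c d
    decide (yes a≡b) = trans (I-≡ a≡b) (sym (I-≡ (to a≡b)))
    decide (no a≢b)  = trans (I-≢ a≢b) (sym (I-≢ (a≢b ∘ from)))

  I-sym : Symmetric (I {n})
  I-sym a b = I-cong-⇔ {a = a} {b} {b} {a} ≡.sym ≡.sym

  I-injective : (f : Fin n → Fin m) → (∀ {a b} → f a ≡ f b → a ≡ b) → ∀ a b → I (f a) (f b) ≈ I a b
  I-injective f f-inj a b = I-cong-⇔ {a = f a} {f b} {a} {b} f-inj (≡.cong f)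

  I-·ᵥ : (y : Vector Carrier n) → I ·ᵥ y ≋ y
  I-·ᵥ {suc n} y zero = begin
    (I ·ᵥ y) zero
      ≈⟨ +-cong (trans (*-congʳ (I-refl {suc n} zero)) (*-identityˡ _))
                (sum-zero {f = λ j → I zero (suc j) * y (suc j)}
                          (λ j → trans (*-congʳ (I-≢ {a = zero} {suc j} λ ())) (zeroˡ _))) ⟩
    y zero + 0#  ≈⟨ +-identityʳ _ ⟩
    y zero       ∎
  I-·ᵥ {suc n} y (suc a) = begin
    (I ·ᵥ y) (suc a)
      ≈⟨ +-cong (trans (*-congʳ (I-≢ {a = suc a} {zero} λ ())) (zeroˡ _))
                (sum-cong-≋ (λ j → *-congʳ (I-injective suc suc-injective a j))) ⟩
    0# + (I ·ᵥ (y ∘ suc)) a  ≈⟨ +-identityˡ _ ⟩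
    (I ·ᵥ (y ∘ suc)) a       ≈⟨ I-·ᵥ (y ∘ suc) a ⟩
    y (suc a)                ∎

  ·-identityˡ : (X : Matrix n m) → (I · X) ≈ₘ X
  ·-identityˡ X a b = I-·ᵥ (λ j → X j b) a

  ·-identityʳ : (X : Matrix n m) → (X · I) ≈ₘ X
  ·-identityʳ X a b = trans (sum-cong-≋ (λ j → trans (*-comm _ _) (*-congʳ (I-sym j b)))) (I-·ᵥ (X a) b)

  leftInverse⇒injective : {B C : Matrix n n} → (C · B) ≈ₘ I → ∀ {y} → B ·ᵥ y ≋ 0ᵥ → y ≋ 0ᵥ
  leftInverse⇒injective {B = B} {C} CB≈I {y} By≈0 l = begin
    y l               ≈⟨ sym (I-·ᵥ y l) ⟩
    (I ·ᵥ y) l        ≈⟨ sum-cong-≋ (λ j → *-congʳ (sym (CB≈I l j))) ⟩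
    (C · B ·ᵥ y) l    ≈⟨ ·ᵥ-assoc C B y l ⟩
    (C ·ᵥ (B ·ᵥ y)) l ≈⟨ sum-zero (λ j → trans (*-congˡ (By≈0 j)) (zeroʳ _)) ⟩
    0#                ∎

  -- For symmetric B, Cᵀ B = (B C)ᵀ = I, and then C = (Cᵀ B) C = Cᵀ (B C) = Cᵀ.
  symmetric-rightInverse⇒nonsingular : {B C : Matrix n n} → Symmetric B → (B · C) ≈ₘ I → Nonsingular B
  symmetric-rightInverse⇒nonsingular {B = B} {C} B-sym BC≈I = C , BC≈I , CB≈I
    where
    CᵀB≈I : ((C ᵀ) · B) ≈ₘ I
    CᵀB≈I a b = trans (sum-cong-≋ (λ j → trans (*-comm _ _) (*-congʳ (B-sym j b))))
                      (trans (BC≈I b a) (I-sym b a))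

    C≈Cᵀ : C ≈ₘ (C ᵀ)
    C≈Cᵀ a b = begin
      C a b                    ≈⟨ sym (·-identityˡ C a b) ⟩
      (I · C) a b              ≈⟨ ·-congʳ C (λ a′ b′ → sym (CᵀB≈I a′ b′)) a b ⟩
      (((C ᵀ) · B) · C) a b    ≈⟨ ·-assoc (C ᵀ) B C a b ⟩
      ((C ᵀ) · (B · C)) a b    ≈⟨ ·-congˡ (C ᵀ) BC≈I a b ⟩
      ((C ᵀ) · I) a b          ≈⟨ ·-identityʳ (C ᵀ) a b ⟩
      C b a                    ∎

    CB≈I : (C · B) ≈ₘ I
    CB≈I a b = trans (·-congʳ B C≈Cᵀ a b) (CᵀB≈I a b)

  -- Gaussian elimination

  pivot : {M : Matrix (suc k) (suc k)} → WeaklyInjective M → ∃₂ λ r y → M r zero * y ≈ 1#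
  pivot {k} {M} M-inj = r , inverse (M r zero) Mr≉0
    where
    r = proj₁ (argmax (λ j → M j zero * M j zero))
    r-max = proj₂ (argmax (λ j → M j zero * M j zero))

    -- r maximises the square of the first column, so Mr = 0 forces that column to vanish.
    Mr≉0 : ¬ (M r zero ≈ 0#)
    Mr≉0 Mr≈0 = ¬¬-∀ column≈0 λ column≈0 →
      M-inj (λ j → I j zero) (λ j → trans (·-identityʳ M j zero) (column≈0 j))
            (λ e≈0 → 0≉1 (trans (sym (e≈0 zero)) (I-refl {suc k} zero)))
      where
      column≈0 : ∀ j → ¬ ¬ (M j zero ≈ 0#)
      column≈0 j = square≈0⇒¬¬≈0 (≤.antisym
        (≤.trans (r-max j) (≤.reflexive (trans (*-cong Mr≈0 Mr≈0) (zeroˡ 0#))))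
        (square-nonneg (M j zero)))

  module Elimination {k} (M : Matrix (suc k) (suc k)) (r : Fin (suc k)) (y : Carrier)
                     (Mr·y≈1 : M r zero * y ≈ 1#) where

    M⁺ : Matrix (suc k) k
    M⁺ j l = M j (suc l)

    multiplier : Vector Carrier k
    multiplier j = M (punchIn r j) zero * y

    reduced : Matrix k k
    reduced j l = M⁺ (punchIn r j) l - multiplier j * M⁺ r l

    reducedRhs : Vector Carrier (suc k) → Vector Carrier k
    reducedRhs b j = b (punchIn r j) - multiplier j * b r

    backSubstitute : Vector Carrier (suc k) → Vector Carrier k → Vector Carrier (suc k)
    backSubstitute b x zero    = y * (b r - (M⁺ ·ᵥ x) r)
    backSubstitute b x (suc l) = x l

    reduced-·ᵥ : ∀ x j → (reduced ·ᵥ x) j ≈ (M⁺ ·ᵥ x) (punchIn r j) - multiplier j * (M⁺ ·ᵥ x) r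
    reduced-·ᵥ x j = begin
      Σ[ (λ l → (M⁺ (punchIn r j) l - μ * M⁺ r l) * x l) ]
        ≈⟨ sum-cong-≋ (λ l → trans ([y-z]x≈yx-zx (x l) _ _)
                                   (+-congˡ (trans (-‿cong (*-assoc μ _ _)) (-‿distribˡ-* μ _)))) ⟩
      Σ[ (λ l → M⁺ (punchIn r j) l * x l + - μ * (M⁺ r l * x l)) ]
        ≈⟨ ∑-distrib-+ (λ l → M⁺ (punchIn r j) l * x l) (λ l → - μ * (M⁺ r l * x l)) ⟩
      (M⁺ ·ᵥ x) (punchIn r j) + Σ[ (λ l → - μ * (M⁺ r l * x l)) ]
        ≈⟨ +-congˡ (trans (sym (*-distribˡ-sum (- μ) (λ l → M⁺ r l * x l))) (sym (-‿distribˡ-* μ _))) ⟩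
      (M⁺ ·ᵥ x) (punchIn r j) - μ * (M⁺ ·ᵥ x) r
        ∎
      where μ = multiplier j

    pivotRow : ∀ b x → (M ·ᵥ backSubstitute b x) r ≈ b r
    pivotRow b x = begin
      M r zero * (y * (b r - T)) + T  ≈⟨ +-congʳ (sym (*-assoc _ _ _)) ⟩
      M r zero * y * (b r - T) + T    ≈⟨ +-congʳ (*-congʳ Mr·y≈1) ⟩
      1# * (b r - T) + T              ≈⟨ +-congʳ (*-identityˡ _) ⟩
      b r - T + T                     ≈⟨ //-rightDividesˡ T (b r) ⟩
      b r                             ∎
      where T = (M⁺ ·ᵥ x) r

    otherRow : ∀ b x j → (M ·ᵥ backSubstitute b x) (punchIn r j) ≈ (reduced ·ᵥ x) j + multiplier j * b r
    otherRow b x j = begin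
      M (punchIn r j) zero * (y * (b r - T)) + A
        ≈⟨ +-congʳ (trans (sym (*-assoc _ _ _)) (x[y-z]≈xy-xz (multiplier j) (b r) T)) ⟩
      (multiplier j * b r - multiplier j * T) + A
        ≈⟨ trans (+-comm _ A) (trans (+-congˡ (+-comm _ _)) (sym (+-assoc A _ _))) ⟩
      (A - multiplier j * T) + multiplier j * b r
        ≈⟨ +-congʳ (sym (reduced-·ᵥ x j)) ⟩
      (reduced ·ᵥ x) j + multiplier j * b r
        ∎
      where T = (M⁺ ·ᵥ x) r
            A = (M⁺ ·ᵥ x) (punchIn r j)

    backSubstitute-solves : ∀ {b x} → reduced ·ᵥ x ≋ reducedRhs b → M ·ᵥ backSubstitute b x ≋ b
    backSubstitute-solves {b} {x} Rx≈b′ = punchIn-elim r (pivotRow b x) λ j → begin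
      (M ·ᵥ backSubstitute b x) (punchIn r j)           ≈⟨ otherRow b x j ⟩
      (reduced ·ᵥ x) j + multiplier j * b r             ≈⟨ +-congʳ (Rx≈b′ j) ⟩
      b (punchIn r j) - multiplier j * b r + multiplier j * b r
        ≈⟨ //-rightDividesˡ (multiplier j * b r) (b (punchIn r j)) ⟩
      b (punchIn r j)                                   ∎

    reduced-weaklyInjective : WeaklyInjective M → WeaklyInjective reduced
    reduced-weaklyInjective M-inj v Rv≈0 =
      ¬¬-map (λ x≈0 l → x≈0 (suc l)) (M-inj (backSubstitute 0ᵥ v) (backSubstitute-solves Rv≈b′))
      where
      Rv≈b′ : reduced ·ᵥ v ≋ reducedRhs 0ᵥ
      Rv≈b′ j = trans (Rv≈0 j) (sym (trans (+-congˡ (-‿cong (zeroʳ (multiplier j)))) (-‿inverseʳ 0#)))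

  weaklyInjective⇒surjective : {M : Matrix n n} → WeaklyInjective M → ∀ b → ∃ λ x → M ·ᵥ x ≋ b
  weaklyInjective⇒surjective {zero}  M-inj b = (λ ()) , (λ ())
  weaklyInjective⇒surjective {suc n} {M} M-inj b =
    let r , y , Mr·y≈1 = pivot {M = M} M-inj
        open Elimination M r y Mr·y≈1
        x , Rx≈b′ = weaklyInjective⇒surjective (reduced-weaklyInjective M-inj) (reducedRhs b)
    in backSubstitute b x , backSubstitute-solves Rx≈b′

  symmetric-weaklyInjective⇒nonsingular : {B : Matrix n n} → Symmetric B → WeaklyInjective B → Nonsingular B
  symmetric-weaklyInjective⇒nonsingular {B = B} B-sym B-inj =
    symmetric-rightInverse⇒nonsingular B-sym (λ j b → proj₂ (column b) j)
    where
    column : ∀ b → ∃ λ x → B ·ᵥ x ≋ (λ j → I j b)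
    column b = weaklyInjective⇒surjective B-inj (λ j → I j b)

  ¬¬-nonzero-zeroOff : (A : Matrix n n) (i : Fin n) → ¬ ¬ (∃ λ u → ZeroOff i (A ·ᵥ u) × ¬ (u ≋ 0ᵥ))
  ¬¬-nonzero-zeroOff A i k = ¬¬-excluded-middle λ
    { (yes A-inj) → solution (weaklyInjective⇒surjective A-inj (λ j → I j i))
    ; (no ¬A-inj) → ¬A-inj λ v Av≈0 v≉0 → k (v , (λ j _ → Av≈0 j) , v≉0)
    }
    where
    solution : (∃ λ u → A ·ᵥ u ≋ (λ j → I j i)) → ⊥
    solution (u , Au≈eᵢ) = k (u , (λ j j≢i → trans (Au≈eᵢ j) (I-≢ j≢i)) , λ u≈0 →
      0≉1 (trans (sym (sum-zero (λ a → trans (*-congˡ (u≈0 a)) (zeroʳ _)))) (trans (Au≈eᵢ i) (I-refl i))))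

  -- Block matrices

  module _ {A : Matrix n n} {B : Matrix m m} where

    ⊕-↑ˡ↑ˡ : ∀ a b → (A ⊕ B) (a ↑ˡ m) (b ↑ˡ m) ≈ A a b
    ⊕-↑ˡ↑ˡ a b rewrite splitAt-↑ˡ n a m | splitAt-↑ˡ n b m = refl

    ⊕-↑ˡ↑ʳ : ∀ a b → (A ⊕ B) (a ↑ˡ m) (n ↑ʳ b) ≈ 0#
    ⊕-↑ˡ↑ʳ a b rewrite splitAt-↑ˡ n a m | splitAt-↑ʳ n m b = refl

    ⊕-↑ʳ↑ˡ : ∀ a b → (A ⊕ B) (n ↑ʳ a) (b ↑ˡ m) ≈ 0#
    ⊕-↑ʳ↑ˡ a b rewrite splitAt-↑ʳ n m a | splitAt-↑ˡ n b m = refl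

    ⊕-↑ʳ↑ʳ : ∀ a b → (A ⊕ B) (n ↑ʳ a) (n ↑ʳ b) ≈ B a b
    ⊕-↑ʳ↑ʳ a b rewrite splitAt-↑ʳ n m a | splitAt-↑ʳ n m b = refl

    ⊕-·-↑ˡ : (Y : Matrix (n +ℕ m) k) → ∀ a q → ((A ⊕ B) · Y) (a ↑ˡ m) q ≈ (A · (Y ∘ (_↑ˡ m))) a q
    ⊕-·-↑ˡ Y a q = begin
      ((A ⊕ B) · Y) (a ↑ˡ m) q
        ≈⟨ sum-↑ n _ ⟩
      Σ[ (λ b → (A ⊕ B) (a ↑ˡ m) (b ↑ˡ m) * Y (b ↑ˡ m) q) ] +
      Σ[ (λ b → (A ⊕ B) (a ↑ˡ m) (n ↑ʳ b) * Y (n ↑ʳ b) q) ]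
        ≈⟨ +-cong (sum-cong-≋ (λ b → *-congʳ (⊕-↑ˡ↑ˡ a b)))
                  (sum-zero (λ b → trans (*-congʳ (⊕-↑ˡ↑ʳ a b)) (zeroˡ _))) ⟩
      (A · (Y ∘ (_↑ˡ m))) a q + 0#
        ≈⟨ +-identityʳ _ ⟩
      (A · (Y ∘ (_↑ˡ m))) a q
        ∎

    ⊕-·-↑ʳ : (Y : Matrix (n +ℕ m) k) → ∀ a q → ((A ⊕ B) · Y) (n ↑ʳ a) q ≈ (B · (Y ∘ (n ↑ʳ_))) a q
    ⊕-·-↑ʳ Y a q = begin
      ((A ⊕ B) · Y) (n ↑ʳ a) q
        ≈⟨ sum-↑ n _ ⟩
      Σ[ (λ b → (A ⊕ B) (n ↑ʳ a) (b ↑ˡ m) * Y (b ↑ˡ m) q) ] +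
      Σ[ (λ b → (A ⊕ B) (n ↑ʳ a) (n ↑ʳ b) * Y (n ↑ʳ b) q) ]
        ≈⟨ +-cong (sum-zero (λ b → trans (*-congʳ (⊕-↑ʳ↑ˡ a b)) (zeroˡ _)))
                  (sum-cong-≋ (λ b → *-congʳ (⊕-↑ʳ↑ʳ a b))) ⟩
      0# + (B · (Y ∘ (n ↑ʳ_))) a q
        ≈⟨ +-identityˡ _ ⟩
      (B · (Y ∘ (n ↑ʳ_))) a q
        ∎

  block : Matrix n n → Matrix n m → Matrix m n → Matrix m m → Matrix (n +ℕ m) (n +ℕ m)
  block {n} X₁₁ X₁₂ X₂₁ X₂₂ p q with splitAt n p | splitAt n q
  ... | inj₁ a | inj₁ b = X₁₁ a b
  ... | inj₁ a | inj₂ b = X₁₂ a b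
  ... | inj₂ a | inj₁ b = X₂₁ a b
  ... | inj₂ a | inj₂ b = X₂₂ a b

  module _ {X₁₁ : Matrix n n} {X₁₂ : Matrix n m} {X₂₁ : Matrix m n} {X₂₂ : Matrix m m} where

    private
      X = block X₁₁ X₁₂ X₂₁ X₂₂

    block-↑ˡ↑ˡ : ∀ a b → X (a ↑ˡ m) (b ↑ˡ m) ≈ X₁₁ a b
    block-↑ˡ↑ˡ a b rewrite splitAt-↑ˡ n a m | splitAt-↑ˡ n b m = refl

    block-↑ˡ↑ʳ : ∀ a b → X (a ↑ˡ m) (n ↑ʳ b) ≈ X₁₂ a b
    block-↑ˡ↑ʳ a b rewrite splitAt-↑ˡ n a m | splitAt-↑ʳ n m b = refl

    block-↑ʳ↑ˡ : ∀ a b → X (n ↑ʳ a) (b ↑ˡ m) ≈ X₂₁ a b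
    block-↑ʳ↑ˡ a b rewrite splitAt-↑ʳ n m a | splitAt-↑ˡ n b m = refl

    block-↑ʳ↑ʳ : ∀ a b → X (n ↑ʳ a) (n ↑ʳ b) ≈ X₂₂ a b
    block-↑ʳ↑ʳ a b rewrite splitAt-↑ʳ n m a | splitAt-↑ʳ n m b = refl

    block-symmetric : Symmetric X₁₁ → (∀ a b → X₁₂ a b ≈ X₂₁ b a) → Symmetric X₂₂ → Symmetric X
    block-symmetric X₁₁-sym X₁₂≈X₂₁ᵀ X₂₂-sym = ↑-elim₂
      (λ a b → quadrant (block-↑ˡ↑ˡ a b) (block-↑ˡ↑ˡ b a) (X₁₁-sym a b))
      (λ a b → quadrant (block-↑ˡ↑ʳ a b) (block-↑ʳ↑ˡ b a) (X₁₂≈X₂₁ᵀ a b))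
      (λ a b → quadrant (block-↑ʳ↑ˡ a b) (block-↑ˡ↑ʳ b a) (sym (X₁₂≈X₂₁ᵀ b a)))
      (λ a b → quadrant (block-↑ʳ↑ʳ a b) (block-↑ʳ↑ʳ b a) (X₂₂-sym a b))
      where
      quadrant : ∀ {x y u v} → x ≈ u → y ≈ v → u ≈ v → x ≈ y
      quadrant x≈u y≈v u≈v = trans x≈u (trans u≈v (sym y≈v))

    ⊕-⊙-block : {A : Matrix n n} {B : Matrix m m} →
                (A ⊙ X₁₁) ≈ₘ O → (B ⊙ X₂₂) ≈ₘ O → ((A ⊕ B) ⊙ X) ≈ₘ O
    ⊕-⊙-block {A} {B} A⊙X₁₁≈O B⊙X₂₂≈O = ↑-elim₂
      (λ a b → trans (*-cong (⊕-↑ˡ↑ˡ {A = A} {B} a b) (block-↑ˡ↑ˡ a b)) (A⊙X₁₁≈O a b))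
      (λ a b → trans (*-congʳ (⊕-↑ˡ↑ʳ {A = A} {B} a b)) (zeroˡ _))
      (λ a b → trans (*-congʳ (⊕-↑ʳ↑ˡ {A = A} {B} a b)) (zeroˡ _))
      (λ a b → trans (*-cong (⊕-↑ʳ↑ʳ {A = A} {B} a b) (block-↑ʳ↑ʳ a b)) (B⊙X₂₂≈O a b))

    I-⊙-block : (I ⊙ X₁₁) ≈ₘ O → (I ⊙ X₂₂) ≈ₘ O → (I ⊙ X) ≈ₘ O
    I-⊙-block I⊙X₁₁≈O I⊙X₂₂≈O = ↑-elim₂
      (λ a b → trans (*-cong (I-injective (_↑ˡ m) (↑ˡ-injective m _ _) a b) (block-↑ˡ↑ˡ a b))
                     (I⊙X₁₁≈O a b))
      (λ a b → trans (*-congʳ (I-≢ (↑ˡ≢↑ʳ a b))) (zeroˡ _))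
      (λ a b → trans (*-congʳ (I-≢ (↑ˡ≢↑ʳ b a ∘ ≡.sym))) (zeroˡ _))
      (λ a b → trans (*-cong (I-injective (n ↑ʳ_) (↑ʳ-injective n _ _) a b) (block-↑ʳ↑ʳ a b))
                     (I⊙X₂₂≈O a b))

    ⊕-·-block-zeroOffRow : {A : Matrix n n} {B : Matrix m m} {i : Fin n} →
                           ZeroOffRow i (A · X₁₁) → ZeroOffRow i (A · X₁₂) →
                           (B · X₂₁) ≈ₘ O → (B · X₂₂) ≈ₘ O →
                           ZeroOffRow (i ↑ˡ m) ((A ⊕ B) · X)
    ⊕-·-block-zeroOffRow {A} {B} AX₁₁-zero AX₁₂-zero BX₂₁≈O BX₂₂≈O = ↑-elim₂
      (λ a b a≢i → via A (⊕-·-↑ˡ X a (b ↑ˡ m)) (λ c → block-↑ˡ↑ˡ c b)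
                       (AX₁₁-zero a b (a≢i ∘ ≡.cong (_↑ˡ m))))
      (λ a b a≢i → via A (⊕-·-↑ˡ X a (n ↑ʳ b)) (λ c → block-↑ˡ↑ʳ c b)
                       (AX₁₂-zero a b (a≢i ∘ ≡.cong (_↑ˡ m))))
      (λ a b _ → via B (⊕-·-↑ʳ X a (b ↑ˡ m)) (λ c → block-↑ʳ↑ˡ c b) (BX₂₁≈O a b))
      (λ a b _ → via B (⊕-·-↑ʳ X a (n ↑ʳ b)) (λ c → block-↑ʳ↑ʳ c b) (BX₂₂≈O a b))
      where
      via : ∀ {j} (M : Matrix j j) {a} {x y : Vector Carrier j} {z} →
            z ≈ (M ·ᵥ x) a → x ≋ y → (M ·ᵥ y) a ≈ 0# → z ≈ 0#
      via M z≈Mx x≈y My≈0 = trans z≈Mx (trans (sum-cong-≋ (λ c → *-congˡ (x≈y c))) My≈0)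

  -- The SNIP of a direct sum

  module _ {A : Matrix n n} {B : Matrix m m} {i : Fin n} where

    SNIP-⊕-block : SNIP (i ↑ˡ m) (A ⊕ B) → (X₁₁ : Matrix n n) (X₁₂ : Matrix n m) (X₂₁ : Matrix m n) →
                   Symmetric X₁₁ → (∀ a b → X₁₂ a b ≈ X₂₁ b a) →
                   (A ⊙ X₁₁) ≈ₘ O → (I ⊙ X₁₁) ≈ₘ O →
                   ZeroOffRow i (A · X₁₁) → ZeroOffRow i (A · X₁₂) → (B · X₂₁) ≈ₘ O →
                   X₁₁ ≈ₘ O × X₁₂ ≈ₘ O
    SNIP-⊕-block snip X₁₁ X₁₂ X₂₁ X₁₁-sym X₁₂≈X₂₁ᵀ A⊙X₁₁≈O I⊙X₁₁≈O
                 AX₁₁-zero AX₁₂-zero BX₂₁≈O =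
      (λ a b → trans (sym (block-↑ˡ↑ˡ {X₂₂ = O} a b)) (X≈O (a ↑ˡ m) (b ↑ˡ m))) ,
      (λ a b → trans (sym (block-↑ˡ↑ʳ {X₂₂ = O} a b)) (X≈O (a ↑ˡ m) (n ↑ʳ b)))
      where
      X≈O : block X₁₁ X₁₂ X₂₁ O ≈ₘ O
      X≈O = snip _ (block-symmetric X₁₁-sym X₁₂≈X₂₁ᵀ (λ _ _ → refl))
                   (⊕-⊙-block A⊙X₁₁≈O (λ _ _ → zeroʳ _))
                   (I-⊙-block I⊙X₁₁≈O (λ _ _ → zeroʳ _))
                   (⊕-·-block-zeroOffRow AX₁₁-zero AX₁₂-zero BX₂₁≈O (·-zeroʳ B))

    SNIP-⊕⇒SNIP : SNIP (i ↑ˡ m) (A ⊕ B) → SNIP i A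
    SNIP-⊕⇒SNIP snip X₁₁ X₁₁-sym A⊙X₁₁≈O I⊙X₁₁≈O AX₁₁-zero =
      proj₁ (SNIP-⊕-block snip X₁₁ O O X₁₁-sym (λ _ _ → refl) A⊙X₁₁≈O I⊙X₁₁≈O AX₁₁-zero
                          (λ j k _ → ·-zeroʳ A j k) (·-zeroʳ B))

    SNIP-⊕⇒⊗≈O : SNIP (i ↑ˡ m) (A ⊕ B) →
                 ∀ {u v} → ZeroOff i (A ·ᵥ u) → B ·ᵥ v ≋ 0ᵥ → (u ⊗ v) ≈ₘ O
    SNIP-⊕⇒⊗≈O snip {u} {v} Au-zero Bv≈0 =
      proj₂ (SNIP-⊕-block snip O (u ⊗ v) (v ⊗ u) (λ _ _ → refl) (λ a b → *-comm (u a) (v b))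
                          (λ _ _ → zeroʳ _) (λ _ _ → zeroʳ _) (λ j k _ → ·-zeroʳ A j k)
                          (λ j k j≢i → trans (·-⊗ A u v j k) (trans (*-congʳ (Au-zero j j≢i)) (zeroˡ _)))
                          (λ j k → trans (·-⊗ B v u j k) (trans (*-congʳ (Bv≈0 j)) (zeroˡ _))))

    SNIP-⊕⇒weaklyInjective : SNIP (i ↑ˡ m) (A ⊕ B) → WeaklyInjective B
    SNIP-⊕⇒weaklyInjective snip v Bv≈0 = ¬¬-∀ λ l vl≉0 →
      ¬¬-nonzero-zeroOff A i λ (u , Au-zero , u≉0) →
        u≉0 (λ a → *≈0⇒≈0 vl≉0 (SNIP-⊕⇒⊗≈O snip Au-zero Bv≈0 a l))

    SNIP×nonsingular⇒SNIP-⊕ : SNIP i A → Nonsingular B → SNIP (i ↑ˡ m) (A ⊕ B)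
    SNIP×nonsingular⇒SNIP-⊕ A-snip (C , _ , CB≈I) X X-sym ⊕⊙X≈O I⊙X≈O ⊕X-zero =
      ↑-elim (λ a → ↑-elim (upperLeft a) (λ b → trans (X-sym _ _) (lower b _))) lower
      where
      lower : ∀ b q → X (n ↑ʳ b) q ≈ 0#
      lower b q = leftInverse⇒injective CB≈I
        (λ l → trans (sym (⊕-·-↑ʳ X l q)) (⊕X-zero (n ↑ʳ l) q (↑ˡ≢↑ʳ i l ∘ ≡.sym))) b

      X₁₁ : Matrix n n
      X₁₁ a b = X (a ↑ˡ m) (b ↑ˡ m)

      upperLeft : ∀ a b → X₁₁ a b ≈ 0#
      upperLeft = A-snip X₁₁ (λ a b → X-sym _ _)
        (λ a b → trans (*-congʳ (sym (⊕-↑ˡ↑ˡ a b))) (⊕⊙X≈O _ _))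
        (λ a b → trans (*-congʳ (sym (I-injective (_↑ˡ m) (↑ˡ-injective m _ _) a b))) (I⊙X≈O _ _))
        (λ a b a≢i → trans (sym (⊕-·-↑ˡ X a (b ↑ˡ m))) (⊕X-zero _ _ (a≢i ∘ ↑ˡ-injective m a i)))

proposition3p5 : ∀ {c ℓ} (R : RealField c ℓ) → let open Matrices R in
    (n m : ℕ) (A : Matrix n n) (B : Matrix m m) (i : Fin n) →
    Symmetric A → Symmetric B →
    SNIP (i ↑ˡ m) (A ⊕ B) ⇔ (SNIP i A × Nonsingular B)
proposition3p5 R n m A B i _ B-sym = mk⇔
  (λ snip → SNIP-⊕⇒SNIP R {A = A} {B} snip ,
            symmetric-weaklyInjective⇒nonsingular R B-sym (SNIP-⊕⇒weaklyInjective R {A = A} {B} snip))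
  (λ (A-snip , B-nonsingular) → SNIP×nonsingular⇒SNIP-⊕ R {A = A} {B} A-snip B-nonsingular)
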